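{- Let $A$ be the vertex–arc incidence matrix of $G_d$, let $\succ$ be any term order, and let $\mathbf{c}=(c_{i,j})_{1\le i<j\le d}\in\mathbb{R}^n$ satisfy $c_{i,j}+c_{j,k}>c_{i,k}$ for all $i<j<k$ and $c_{i,k}+c_{j,l}>c_{i,l}+c_{j,k}$ for all $i<j<k<l$. Then the reduced Gröbner basis of $I_A$ with respect to $\succ_{\mathbf{c}}$ is $\{x_{i,j}x_{j,k}-x_{i,k}: i<j<k\}\cup\{x_{i,k}x_{j,l}-x_{i,l}x_{j,k}: i<j<k<l\}$.
   Context: $G_d$ has vertices $1,\dots,d$ and arcs $(i,j)$, $1\le i<j\le d$, directed from $i$ to $j$; $n=\binom d2$. Its vertex–arc incidence matrix $A$ has in the column of arc $(i,j)$ entry $1$ in row $i$, $-1$ in row $j$, $0$ elsewhere. $I_A=\langle\mathbf{x}^{\mathbf{u}}-\mathbf{x}^{\mathbf{v}}:A\mathbf{u}=A\mathbf{v},\ \mathbf{u},\mathbf{v}\in\mathbb{N}^n\rangle\subseteq k[x_{i,j}]$. The refinement $\succ_{\mathbf{c}}$ of $\mathbf{c}$ by $\succ$ orders monomials by $\mathbf{x}^{\mathbf{u}}\succ_{\mathbf{c}}\mathbf{x}^{\mathbf{v}}$ iff $\mathbf{c}\cdot\mathbf{u}>\mathbf{c}\cdot\mathbf{v}$, or $\mathbf{c}\cdot\mathbf{u}=\mathbf{c}\cdot\mathbf{v}$ and $\mathbf{x}^{\mathbf{u}}\succ\mathbf{x}^{\mathbf{v}}$. Since $I_A$ is homogeneous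 for the positive grading $\deg x_{i,j}=j-i$, $\succ_{\mathbf{c}}$ acts as a term order on $I_A$ for every $\mathbf{c}$, and reduced Gröbner bases with respect to it exist. -}

module Defs where

open import Level using (Level; _⊔_) renaming (suc to lsuc)
open import Data.Bool using (if_then_else_; _∧_)
open import Data.Nat as ℕ using (ℕ)
open import Data.Fin as Fin using (Fin)
open import Data.Fin.Properties using (_<?_; <-trans; all?)
open import Data.Empty using (⊥-elim)
open import Relation.Nullary.Decidable using (map′; recompute)
open import Data.Integer as ℤ using (ℤ)
open import Data.List using (List; []; _∷_; _++_; map; foldr; concatMap; allFin)
open import Data.Product using (Σ; Σ-syntax; _×_; _,_)
open import Data.Sum using (_⊎_)
open import Relation.Nullary using (¬_; Dec; yes; no; does)
open import Relation.Nullary.Decidable using (⌊_⌋)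
open import Relation.Binary.PropositionalEquality using (_≡_; refl)
open import Relation.Binary.Structures using (IsStrictTotalOrder)
open import Algebra.Bundles using (CommutativeRing)

record Field c ℓ : Set (lsuc (c ⊔ ℓ)) where
  field
    commutativeRing : CommutativeRing c ℓ
  open CommutativeRing commutativeRing public
  field
    1≉0     : ¬ (1# ≈ 0#)
    inverse : ∀ x → ¬ (x ≈ 0#) → Σ Carrier (λ y → x * y ≈ 1#)

record OrderedField c ℓ ℓ< : Set (lsuc (c ⊔ ℓ ⊔ ℓ<)) where
  field
    baseField : Field c ℓ
  open Field baseField public
  infix 4 _<_
  field
    _<_                : Carrier → Carrier → Set ℓ<
    isStrictTotalOrder : IsStrictTotalOrder _≈_ _<_
    +-mono-<           : ∀ {x y} z → x < y → x + z < y + z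
    *-pos              : ∀ {x y} → 0# < x → 0# < y → 0# < x * y

-- The graph G_d: vertices Fin d (vertex i ↔ i+1), arcs (i,j) with i < j.

record Var (d : ℕ) : Set where
  constructor arc
  field
    src tgt : Fin d
    .lt     : src Fin.< tgt

sumVar : ∀ {a} {A : Set a} {d : ℕ} → (A → A → A) → A → (Var d → A) → A
sumVar {A = A} {d} _⊕_ e f =
  foldr (λ i acc → foldr (λ j acc′ → step i j acc′) acc (allFin d)) e (allFin d)
  where
  step : Fin d → Fin d → A → A
  step i j acc with i <? j
  ... | yes p = f (arc i j p) ⊕ acc
  ... | no _  = acc

Monomial : ℕ → Set
Monomial d = Var d → ℕ

module _ {d : ℕ} where

  infix 4 _≗ᵐ_ _∣ᵐ_
  _≗ᵐ_ : Monomial d → Monomial d → Set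
  u ≗ᵐ v = ∀ e → u e ≡ v e

  _∣ᵐ_ : Monomial d → Monomial d → Set
  u ∣ᵐ v = ∀ e → u e ℕ.≤ v e

  1ᵐ : Monomial d
  1ᵐ _ = 0

  infixl 7 _·ᵐ_
  _·ᵐ_ : Monomial d → Monomial d → Monomial d
  (u ·ᵐ v) e = u e ℕ.+ v e

  unit : Var d → Monomial d
  unit (arc i j _) (arc i′ j′ _) =
    if ⌊ i Fin.≟ i′ ⌋ ∧ ⌊ j Fin.≟ j′ ⌋ then 1 else 0

  _≟ᵐ_ : (u v : Monomial d) → Dec (u ≗ᵐ v)
  u ≟ᵐ v = map′ (λ h → λ { (arc i j p) → h i j (recompute (i <? j) p) })
                (λ eq i j p → eq (arc i j p))
                (all? (λ i → all? (λ j → chk i j)))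
    where
    chk : ∀ i j → Dec ((p : i Fin.< j) → u (arc i j p) ≡ v (arc i j p))
    chk i j with i <? j
    ... | yes p = map′ (λ h _ → h) (λ f → f p) (u (arc i j p) ℕ.≟ v (arc i j p))
    ... | no ¬p = yes (λ p → ⊥-elim (¬p p))

  incidence : Fin d → Var d → ℤ
  incidence m (arc i j _) =
    if ⌊ m Fin.≟ i ⌋ then ℤ.+ 1 else (if ⌊ m Fin.≟ j ⌋ then ℤ.- (ℤ.+ 1) else ℤ.+ 0)

  A·_ : Monomial d → Fin d → ℤ
  (A· u) m = sumVar ℤ._+_ (ℤ.+ 0) (λ e → incidence m e ℤ.* ℤ.+ (u e))

record TermOrder (d : ℕ) ℓ : Set (lsuc ℓ) where
  infix 4 _≻_ _≺_
  field
    _≻_ : Monomial d → Monomial d → Set ℓ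
  _≺_ : Monomial d → Monomial d → Set ℓ
  u ≺ v = v ≻ u
  field
    isStrictTotalOrder : IsStrictTotalOrder _≗ᵐ_ _≺_
    multiplicative     : ∀ {u v} w → u ≻ v → u ·ᵐ w ≻ v ·ᵐ w
    one-least          : ∀ u → ¬ (u ≗ᵐ 1ᵐ) → u ≻ 1ᵐ

-- Polynomials in k[x_{i,j}] over a field k, as finite lists of terms
-- (coefficient, monomial); equality is equality of all coefficients.

module Polynomials {c ℓ} (K : Field c ℓ) (d : ℕ) where
  open Field K

  Poly : Set c
  Poly = List (Carrier × Monomial d)

  coeff : Poly → Monomial d → Carrier
  coeff [] u = 0#
  coeff ((a , w) ∷ p) u with w ≟ᵐ u
  ... | yes _ = a + coeff p u
  ... | no _  = coeff p u

  infix 4 _≈ᴾ_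
  _≈ᴾ_ : Poly → Poly → Set ℓ
  p ≈ᴾ q = ∀ u → coeff p u ≈ coeff q u

  0ᴾ : Poly
  0ᴾ = []

  infixl 6 _+ᴾ_ _-ᴾ_
  infixl 7 _*ᴾ_
  _+ᴾ_ : Poly → Poly → Poly
  p +ᴾ q = p ++ q

  -ᴾ_ : Poly → Poly
  -ᴾ p = map (λ { (a , w) → (- a , w) }) p

  _-ᴾ_ : Poly → Poly → Poly
  p -ᴾ q = p +ᴾ (-ᴾ q)

  _*ᴾ_ : Poly → Poly → Poly
  p *ᴾ q = concatMap (λ { (a , w) → map (λ { (b , v) → (a * b , w ·ᵐ v) }) q }) p

  mon : Monomial d → Poly
  mon u = (1# , u) ∷ []

  x : Var d → Poly
  x e = mon (unit e)

  InSupp : Poly → Monomial d → Set ℓ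
  InSupp p u = ¬ (coeff p u ≈ 0#)

  IsLeading : ∀ {ℓo} → (Monomial d → Monomial d → Set ℓo) → Poly → Monomial d → Set (ℓ ⊔ ℓo)
  IsLeading _>_ p u = InSupp p u × (∀ v → InSupp p v → ¬ (v ≗ᵐ u) → u > v)

  combo : ∀ {s} {S : Poly → Set s} → List (Poly × Σ Poly S) → Poly
  combo = foldr (λ { (h , g , _) acc → h *ᴾ g +ᴾ acc }) 0ᴾ

  InIdeal : ∀ {s} → (Poly → Set s) → Poly → Set (c ⊔ ℓ ⊔ s)
  InIdeal S p = Σ (List (Poly × Σ Poly S)) (λ L → p ≈ᴾ combo L)

  ToricGen : Poly → Set c
  ToricGen g = Σ (Monomial d) (λ u → Σ (Monomial d) (λ v →
                 (∀ m → (A· u) m ≡ (A· v) m) × g ≡ mon u -ᴾ mon v))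

  I-A : Poly → Set (c ⊔ ℓ)
  I-A = InIdeal ToricGen

  record IsReducedGB {ℓo ℓi ℓg} (_>_ : Monomial d → Monomial d → Set ℓo)
                     (I : Poly → Set ℓi) (G : Poly → Set ℓg)
                     : Set (c ⊔ ℓ ⊔ ℓo ⊔ ℓi ⊔ ℓg) where
    field
      ⊆I        : ∀ g → G g → I g
      monic     : ∀ g → G g → Σ (Monomial d) (λ u → IsLeading _>_ g u × coeff g u ≈ 1#)
      -- in(I) = ⟨ in(g) : g ∈ G ⟩
      groebner  : ∀ f → I f → ∀ u → IsLeading _>_ f u →
                  Σ Poly (λ g → G g × Σ (Monomial d) (λ w → IsLeading _>_ g w × w ∣ᵐ u))
      reduced   : ∀ g g′ → G g → G g′ → ¬ (g ≈ᴾ g′) →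
                  ∀ w → IsLeading _>_ g′ w → ∀ v → InSupp g v → ¬ (w ∣ᵐ v)

  GdBasis : Poly → Set c
  GdBasis g =
    Σ (Fin d) (λ i → Σ (Fin d) (λ j → Σ (Fin d) (λ k →
      Σ (i Fin.< j) (λ p → Σ (j Fin.< k) (λ q →
        g ≡ x (arc i j p) *ᴾ x (arc j k q) -ᴾ x (arc i k (<-trans p q)))))))
    ⊎
    Σ (Fin d) (λ i → Σ (Fin d) (λ j → Σ (Fin d) (λ k → Σ (Fin d) (λ l →
      Σ (i Fin.< j) (λ p → Σ (j Fin.< k) (λ q → Σ (k Fin.< l) (λ r →
        g ≡ x (arc i k (<-trans p q)) *ᴾ x (arc j l (<-trans q r))
            -ᴾ x (arc i l (<-trans p (<-trans q r))) *ᴾ x (arc j k q))))))))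

module Weights {c′ ℓ′ ℓ<} (R : OrderedField c′ ℓ′ ℓ<) (d : ℕ) where
  open OrderedField R

  fromℕ : ℕ → Carrier
  fromℕ ℕ.zero    = 0#
  fromℕ (ℕ.suc n) = 1# + fromℕ n

  weight : (Var d → Carrier) → Monomial d → Carrier
  weight w u = sumVar _+_ 0# (λ e → w e * fromℕ (u e))

  refine : ∀ {ℓo} → (Var d → Carrier) → (Monomial d → Monomial d → Set ℓo) →
           Monomial d → Monomial d → Set (ℓ′ ⊔ ℓ< ⊔ ℓo)
  refine w _≻_ u v = (weight w v < weight w u) ⊎ ((weight w u ≈ weight w v) × u ≻ v)

  TriangleCond : (Var d → Carrier) → Set ℓ<
  TriangleCond w = ∀ i j k (p : i Fin.< j) (q : j Fin.< k) →
    w (arc i k (<-trans p q)) < w (arc i j p) + w (arc j k q)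

  QuadCond : (Var d → Carrier) → Set ℓ<
  QuadCond w = ∀ i j k l (p : i Fin.< j) (q : j Fin.< k) (r : k Fin.< l) →
    w (arc i l (<-trans p (<-trans q r))) + w (arc j k q)
      < w (arc i k (<-trans p q)) + w (arc j l (<-trans q r))

-- Reducing a monomial modulo the binomials x_a x_b - x^t of the basis stays inside its fibre
-- {v : A v = A u}, and by the two inequalities on c it strictly lowers the weight; a ℕ-valued
-- rank decreases as well, so reduction ends at a standard monomial, one divisible by no path
-- x_ij x_jk and no cross x_ik x_jl. A fibre contains only one standard monomial: the leftmost
-- vertex with net in-flow is entered by an arc from the nearest vertex with net out-flow to
-- its left (anything else creates a cross), so two standard monomials of a fibre share an arc
-- and can be peeled off together. Hence the standard monomial is strictly the lightest in its
-- fibre. The coefficients of any f ∈ I_A sum to zero over each fibre; if the leading monomial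
-- of f were standard, all other monomials of its fibre would be heavier, hence absent from f,
-- and its own coefficient would vanish. So every leading monomial of I_A is divisible by a path
-- or a cross. The basis is reduced because its trailing monomials x_ik and x_il x_jk are
-- standard and the two leading arcs determine the binomial.

module Submission where

open import Defs
open import Algebra.Bundles using (CommutativeMonoid)
open import Data.Bool using (if_then_else_)
open import Data.Empty using (⊥; ⊥-elim)
open import Data.Fin as Fin using (Fin; zero; suc)
open import Data.Fin.Properties as Finₚ using (_<?_; any?; all?; suc-injective)
open import Data.Integer as ℤ using (ℤ; +_)
import Data.Integer.Properties as ℤₚ
import Data.Integer.Tactic.RingSolver as ℤ-Solver
import Data.Nat.Tactic.RingSolver as ℕ-Solver
open import Algebra.Properties.AbelianGroup ℤₚ.+-0-abelianGroup using (∙-cancelʳ)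
open import Data.List using ([]; _∷_; _++_; foldr; tabulate; allFin; length)
open import Data.Nat as ℕ using (ℕ; z≤n; s≤s)
import Data.Nat.Properties as ℕₚ
open import Data.Product using (Σ; Σ-syntax; ∃; _×_; _,_; proj₁; proj₂; map₂)
open import Data.Sum using (_⊎_; inj₁; inj₂)
open import Function using (_∘_; case_of_)
open import Level using (_⊔_)
open import Relation.Binary.Definitions using (DecidableEquality)
open import Relation.Binary.Structures using (IsStrictTotalOrder)
open import Relation.Binary.Bundles using (StrictPartialOrder)
open import Relation.Binary.PropositionalEquality as ≡ using (_≡_; _≢_; refl; cong)
open import Relation.Nullary using (¬_; Dec; yes; no)
open import Relation.Nullary.Decidable using (recompute; ⌊_⌋; map′; _×-dec_; _⊎-dec_)
open import Relation.Unary using (Pred; Decidable)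
open import Induction.WellFounded using (Acc; acc)
open import Data.Nat.Induction using (<-wellFounded)

module _ {d : ℕ} where

  infix 4 _≟ᵛ_ _∈ᵐ_

  _≟ᵛ_ : DecidableEquality (Var d)
  arc i j _ ≟ᵛ arc i′ j′ _ with i Fin.≟ i′ | j Fin.≟ j′
  ... | yes refl | yes refl = yes refl
  ... | no i≢i′  | _        = no (i≢i′ ∘ cong Var.src)
  ... | yes _    | no j≢j′  = no (j≢j′ ∘ cong Var.tgt)

  unit-self : ∀ (a : Var d) → unit a a ≡ 1
  unit-self (arc i j _) with i Fin.≟ i | j Fin.≟ j
  ... | yes _   | yes _   = refl
  ... | no i≢i  | _       = ⊥-elim (i≢i refl)
  ... | yes _   | no j≢j  = ⊥-elim (j≢j refl)

  unit-other : ∀ {a e : Var d} → a ≢ e → unit a e ≡ 0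
  unit-other {arc i j _} {arc i′ j′ _} a≢e with i Fin.≟ i′ | j Fin.≟ j′
  ... | yes refl | yes refl = ⊥-elim (a≢e refl)
  ... | no _     | _        = refl
  ... | yes _    | no _     = refl

  _∈ᵐ_ : Var d → Monomial d → Set
  a ∈ᵐ u = 1 ℕ.≤ u a

  ≗ᵐ-sym : ∀ {u v : Monomial d} → u ≗ᵐ v → v ≗ᵐ u
  ≗ᵐ-sym u≗v e = ≡.sym (u≗v e)

  ≗ᵐ-trans : ∀ {u v t : Monomial d} → u ≗ᵐ v → v ≗ᵐ t → u ≗ᵐ t
  ≗ᵐ-trans u≗v v≗t e = ≡.trans (u≗v e) (v≗t e)

  ≗ᵐ⇒∣ᵐ : ∀ {u v : Monomial d} → u ≗ᵐ v → u ∣ᵐ v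
  ≗ᵐ⇒∣ᵐ u≗v e = ℕₚ.≤-reflexive (u≗v e)

  ∣ᵐ-trans : ∀ {u v t : Monomial d} → u ∣ᵐ v → v ∣ᵐ t → u ∣ᵐ t
  ∣ᵐ-trans u∣v v∣t e = ℕₚ.≤-trans (u∣v e) (v∣t e)

  infixl 7 _∸ᵐ_
  _∸ᵐ_ : Monomial d → Monomial d → Monomial d
  (u ∸ᵐ w) e = u e ℕ.∸ w e

  ∸ᵐ-∣ᵐ : ∀ u w → u ∸ᵐ w ∣ᵐ u
  ∸ᵐ-∣ᵐ u w e = ℕₚ.m∸n≤m (u e) (w e)

  ∸ᵐ-·ᵐ : ∀ {u w} → w ∣ᵐ u → u ≗ᵐ u ∸ᵐ w ·ᵐ w
  ∸ᵐ-·ᵐ w∣u e = ≡.sym (ℕₚ.m∸n+n≡m (w∣u e))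

  ∈ᵐ-∣ᵐ : ∀ {a u v} → a ∈ᵐ u → u ∣ᵐ v → a ∈ᵐ v
  ∈ᵐ-∣ᵐ {a} a∈u u∣v = ℕₚ.≤-trans a∈u (u∣v a)

  ∉ᵐ⇒0 : ∀ {u : Monomial d} {e} → ¬ e ∈ᵐ u → u e ≡ 0
  ∉ᵐ⇒0 e∉u = ℕₚ.n≤0⇒n≡0 (ℕₚ.≮⇒≥ e∉u)

  ∉ᵐ-∣ᵐ : ∀ {u v : Monomial d} {e} → v ∣ᵐ u → ¬ e ∈ᵐ u → v e ≡ 0
  ∉ᵐ-∣ᵐ {u} {e = e} v∣u e∉u = ℕₚ.n≤0⇒n≡0 (ℕₚ.≤-trans (v∣u e) (ℕₚ.≤-reflexive (∉ᵐ⇒0 {u = u} e∉u)))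

  unit-∣ᵐ : ∀ {a u} → a ∈ᵐ u → unit a ∣ᵐ u
  unit-∣ᵐ {a} a∈u e with a ≟ᵛ e
  ... | yes refl = ℕₚ.≤-trans (ℕₚ.≤-reflexive (unit-self a)) a∈u
  ... | no a≢e   = ℕₚ.≤-trans (ℕₚ.≤-reflexive (unit-other a≢e)) z≤n

  unit·unit-∣ᵐ : ∀ {a b u} → a ∈ᵐ u → b ∈ᵐ u → a ≢ b → unit a ·ᵐ unit b ∣ᵐ u
  unit·unit-∣ᵐ {a} {b} a∈u b∈u a≢b e with a ≟ᵛ e | b ≟ᵛ e
  ... | yes refl | yes refl = ⊥-elim (a≢b refl)
  ... | yes refl | no b≢e   rewrite unit-self a | unit-other b≢e = a∈u
  ... | no a≢e   | yes refl rewrite unit-other a≢e | unit-self b = b∈u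
  ... | no a≢e   | no b≢e   rewrite unit-other a≢e | unit-other b≢e = z≤n

  ∈ᵐ-unit·unitˡ : ∀ a b → a ∈ᵐ unit a ·ᵐ unit b
  ∈ᵐ-unit·unitˡ a b rewrite unit-self a = s≤s z≤n

  ∈ᵐ-unit·unitʳ : ∀ a b → b ∈ᵐ unit a ·ᵐ unit b
  ∈ᵐ-unit·unitʳ a b rewrite unit-self b = ℕₚ.m≤n+m 1 (unit a b)

  ∈ᵐ-unit : ∀ {e a} → e ∈ᵐ unit a → e ≡ a
  ∈ᵐ-unit {e} {a} e∈a with a ≟ᵛ e
  ... | yes refl = refl
  ... | no a≢e   = ⊥-elim (ℕₚ.<-irrefl (≡.sym (unit-other a≢e)) e∈a)

  ∈ᵐ-unit·unit : ∀ {e a b} → e ∈ᵐ unit a ·ᵐ unit b → e ≡ a ⊎ e ≡ b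
  ∈ᵐ-unit·unit {e} {a} {b} e∈ab with a ≟ᵛ e
  ... | yes refl = inj₁ refl
  ... | no a≢e   rewrite unit-other a≢e = inj₂ (∈ᵐ-unit e∈ab)

module ArcSum {c ℓ} (M : CommutativeMonoid c ℓ) {d : ℕ} where
  open CommutativeMonoid M renaming (refl to ≈-refl)
  open import Algebra.Properties.CommutativeMonoid.Sum M using (sum; sum-cong-≋; ∑-distrib-+)
  open import Relation.Binary.Reasoning.Setoid setoid

  sum-closed : ∀ {p} (P : Pred Carrier p) → P ε → (∀ {x y} → P x → P y → P (x ∙ y)) →
               ∀ {n} (f : Fin n → Carrier) → (∀ i → P (f i)) → P (sum f)
  sum-closed P Pε P∙ {ℕ.zero}  f Pf = Pε
  sum-closed P Pε P∙ {ℕ.suc n} f Pf = P∙ (Pf zero) (sum-closed P Pε P∙ (f ∘ suc) (Pf ∘ suc))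

  sum-zero : ∀ {n} (f : Fin n → Carrier) → (∀ i → f i ≈ ε) → sum f ≈ ε
  sum-zero = sum-closed (_≈ ε) ≈-refl (λ x≈ε y≈ε → trans (∙-cong x≈ε y≈ε) (identityˡ ε))

  sum-single : ∀ {n} (f : Fin n → Carrier) (i : Fin n) → (∀ j → j ≢ i → f j ≈ ε) → sum f ≈ f i
  sum-single f zero f≈ε =
    trans (∙-congˡ (sum-zero (f ∘ suc) (λ j → f≈ε (suc j) λ ()))) (identityʳ (f zero))
  sum-single f (suc i) f≈ε =
    trans (∙-congʳ (f≈ε zero λ ())) (trans (identityˡ _)
      (sum-single (f ∘ suc) i (λ j j≢i → f≈ε (suc j) (j≢i ∘ suc-injective))))

  grid : (Var d → Carrier) → Fin d → Fin d → Carrier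
  grid f i j with i <? j
  ... | yes i<j = f (arc i j i<j)
  ... | no _    = ε

  ∑∑ : (Fin d → Fin d → Carrier) → Carrier
  ∑∑ g = sum (λ i → sum (g i))

  foldr-∙ : ∀ {X : Set} (step : X → Carrier → Carrier) (g : X → Carrier) →
            (∀ x a → step x a ≈ g x ∙ a) →
            ∀ xs a → foldr step a xs ≈ foldr (λ x → g x ∙_) ε xs ∙ a
  foldr-∙ step g step≈ []       a = sym (identityˡ a)
  foldr-∙ step g step≈ (x ∷ xs) a = begin
    step x (foldr step a xs)                 ≈⟨ step≈ x _ ⟩
    g x ∙ foldr step a xs                    ≈⟨ ∙-congˡ (foldr-∙ step g step≈ xs a) ⟩
    g x ∙ (foldr (λ x → g x ∙_) ε xs ∙ a)    ≈⟨ assoc _ _ _ ⟨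
    g x ∙ foldr (λ x → g x ∙_) ε xs ∙ a      ∎

  foldr-tabulate : ∀ {n} (g : Fin d → Carrier) (h : Fin n → Fin d) →
                   foldr (λ x → g x ∙_) ε (tabulate h) ≡ sum (g ∘ h)
  foldr-tabulate {ℕ.zero}  g h = refl
  foldr-tabulate {ℕ.suc n} g h = cong (g (h zero) ∙_) (foldr-tabulate g (h ∘ suc))

  mutual
    sumVar≈∑∑ : ∀ f → sumVar _∙_ ε f ≈ ∑∑ (grid f)
    sumVar≈∑∑ f = begin
      sumVar _∙_ ε f
        ≈⟨ foldr-∙ _ (λ i → foldr (λ j → grid f i j ∙_) ε (allFin d))
                   (λ i → foldr-∙ _ (grid f i) (sumVar-step f i) (allFin d)) (allFin d) ε ⟩
      foldr (λ i → foldr (λ j → grid f i j ∙_) ε (allFin d) ∙_) ε (allFin d) ∙ ε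
        ≈⟨ identityʳ _ ⟩
      foldr (λ i → foldr (λ j → grid f i j ∙_) ε (allFin d) ∙_) ε (allFin d)
        ≡⟨ foldr-tabulate _ (λ i → i) ⟩
      sum (λ i → foldr (λ j → grid f i j ∙_) ε (allFin d))
        ≈⟨ sum-cong-≋ (λ i → reflexive (foldr-tabulate (grid f i) (λ j → j))) ⟩
      ∑∑ (grid f) ∎

    -- The inner step of sumVar is a local with-function of Defs, so the
    -- type of this lemma can only be given by unification at its use.
    sumVar-step : ∀ f i j a → _ ≈ grid f i j ∙ a
    sumVar-step f i j a with i <? j
    ... | yes _ = ≈-refl
    ... | no _  = sym (identityˡ a)

  grid-closed : ∀ {p} (P : Pred Carrier p) → P ε → ∀ f → (∀ e → P (f e)) → ∀ i j → P (grid f i j)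
  grid-closed P Pε f Pf i j with i <? j
  ... | yes _ = Pf _
  ... | no _  = Pε

  grid-cong : ∀ {f g} → (∀ e → f e ≈ g e) → ∀ i j → grid f i j ≈ grid g i j
  grid-cong f≈g i j with i <? j
  ... | yes _ = f≈g _
  ... | no _  = ≈-refl

  grid-∙ : ∀ f g i j → grid (λ e → f e ∙ g e) i j ≈ grid f i j ∙ grid g i j
  grid-∙ f g i j with i <? j
  ... | yes _ = ≈-refl
  ... | no _  = sym (identityˡ ε)

  sumVar-closed : ∀ {p} (P : Pred Carrier p) → (∀ {x y} → x ≈ y → P x → P y) →
                  P ε → (∀ {x y} → P x → P y → P (x ∙ y)) →
                  ∀ f → (∀ e → P (f e)) → P (sumVar _∙_ ε f)
  sumVar-closed P P-resp Pε P∙ f Pf =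
    P-resp (sym (sumVar≈∑∑ f))
      (sum-closed P Pε P∙ _ λ i → sum-closed P Pε P∙ _ (grid-closed P Pε f Pf i))

  sumVar-cong : ∀ {f g} → (∀ e → f e ≈ g e) → sumVar _∙_ ε f ≈ sumVar _∙_ ε g
  sumVar-cong {f} {g} f≈g = begin
    sumVar _∙_ ε f    ≈⟨ sumVar≈∑∑ f ⟩
    ∑∑ (grid f)       ≈⟨ sum-cong-≋ (λ i → sum-cong-≋ (grid-cong f≈g i)) ⟩
    ∑∑ (grid g)       ≈⟨ sumVar≈∑∑ g ⟨
    sumVar _∙_ ε g    ∎

  sumVar-∙ : ∀ f g → sumVar _∙_ ε (λ e → f e ∙ g e) ≈ sumVar _∙_ ε f ∙ sumVar _∙_ ε g
  sumVar-∙ f g = begin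
    sumVar _∙_ ε (λ e → f e ∙ g e)                       ≈⟨ sumVar≈∑∑ _ ⟩
    ∑∑ (grid (λ e → f e ∙ g e))                          ≈⟨ sum-cong-≋ (λ i → sum-cong-≋ (grid-∙ f g i)) ⟩
    sum (λ i → sum (λ j → grid f i j ∙ grid g i j))      ≈⟨ sum-cong-≋ (λ i → ∑-distrib-+ (grid f i) (grid g i)) ⟩
    sum (λ i → sum (grid f i) ∙ sum (grid g i))          ≈⟨ ∑-distrib-+ (λ i → sum (grid f i)) _ ⟩
    ∑∑ (grid f) ∙ ∑∑ (grid g)                            ≈⟨ ∙-cong (sumVar≈∑∑ f) (sumVar≈∑∑ g) ⟨
    sumVar _∙_ ε f ∙ sumVar _∙_ ε g                      ∎

  sumVar-single : ∀ f a → (∀ e → e ≢ a → f e ≈ ε) → sumVar _∙_ ε f ≈ f a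
  sumVar-single f a@(arc s t s<t) f≈ε = begin
    sumVar _∙_ ε f     ≈⟨ sumVar≈∑∑ f ⟩
    ∑∑ (grid f)        ≈⟨ sum-single _ s (λ i i≢s → sum-zero _ (off-row i≢s)) ⟩
    sum (grid f s)     ≈⟨ sum-single _ t (λ j → off-column j) ⟩
    grid f s t         ≈⟨ on-arc ⟩
    f a                ∎
    where
    off-row : ∀ {i} → i ≢ s → ∀ j → grid f i j ≈ ε
    off-row {i} i≢s j with i <? j
    ... | yes _ = f≈ε _ (i≢s ∘ cong Var.src)
    ... | no _  = ≈-refl
    off-column : ∀ j → j ≢ t → grid f s j ≈ ε
    off-column j j≢t with s <? j
    ... | yes _ = f≈ε _ (j≢t ∘ cong Var.tgt)
    ... | no _  = ≈-refl
    on-arc : grid f s t ≈ f a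
    on-arc with s <? t
    ... | yes _   = ≈-refl
    ... | no s≮t  = ⊥-elim (s≮t (recompute (s <? t) s<t))

module Linear {c ℓ} (M : CommutativeMonoid c ℓ) {d : ℕ}
              (φ : Var d → ℕ → CommutativeMonoid.Carrier M)
              (φ-+ : ∀ e m n → CommutativeMonoid._≈_ M (φ e (m ℕ.+ n)) (CommutativeMonoid._∙_ M (φ e m) (φ e n)))
              (φ-0 : ∀ e → CommutativeMonoid._≈_ M (φ e 0) (CommutativeMonoid.ε M)) where
  open CommutativeMonoid M renaming (refl to ≈-refl)
  open ArcSum M {d}

  L : Monomial d → Carrier
  L u = sumVar _∙_ ε (λ e → φ e (u e))

  L-cong : ∀ {u v} → u ≗ᵐ v → L u ≈ L v
  L-cong u≗v = sumVar-cong (λ e → reflexive (cong (φ e) (u≗v e)))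

  L-· : ∀ u v → L (u ·ᵐ v) ≈ L u ∙ L v
  L-· u v = trans (sumVar-cong (λ e → φ-+ e (u e) (v e))) (sumVar-∙ _ _)

  L-unit : ∀ a → L (unit a) ≈ φ a 1
  L-unit a = trans (sumVar-single _ a (λ e e≢a → trans (reflexive (cong (φ e) (unit-other (e≢a ∘ ≡.sym)))) (φ-0 e)))
                   (reflexive (cong (φ a) (unit-self a)))

  L-∸ᵐ : ∀ {u w} → w ∣ᵐ u → L u ≈ L (u ∸ᵐ w) ∙ L w
  L-∸ᵐ {u} {w} w∣u = trans (L-cong (∸ᵐ-·ᵐ w∣u)) (L-· (u ∸ᵐ w) w)

-- The A-grading

module _ {d : ℕ} where

  open import Data.Integer.Base using (-_; _-_)

  private
    module Row (m : Fin d) =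
      Linear ℤₚ.+-0-commutativeMonoid (λ e n → incidence m e ℤ.* + n)
             (λ e a b → ≡.trans (cong (incidence m e ℤ.*_) (ℤₚ.pos-+ a b)) (ℤₚ.*-distribˡ-+ (incidence m e) (+ a) (+ b)))
             (λ e → ℤₚ.*-zeroʳ (incidence m e))

  infix 4 _∼ᴬ_ _∼ᴬ?_
  _∼ᴬ_ : Monomial d → Monomial d → Set
  u ∼ᴬ v = ∀ m → (A· u) m ≡ (A· v) m

  _∼ᴬ?_ : ∀ u v → Dec (u ∼ᴬ v)
  u ∼ᴬ? v = all? λ m → (A· u) m ℤ.≟ (A· v) m

  A-cong : ∀ {u v} → u ≗ᵐ v → u ∼ᴬ v
  A-cong u≗v m = Row.L-cong m u≗v

  A-·ᵐ : ∀ u v m → (A· (u ·ᵐ v)) m ≡ (A· u) m ℤ.+ (A· v) m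
  A-·ᵐ u v m = Row.L-· m u v

  A-unit : ∀ a m → (A· unit a) m ≡ incidence m a
  A-unit a m = ≡.trans (Row.L-unit m a) (ℤₚ.*-identityʳ (incidence m a))

  A-unit·unit : ∀ a b m → (A· (unit a ·ᵐ unit b)) m ≡ incidence m a ℤ.+ incidence m b
  A-unit·unit a b m = ≡.trans (A-·ᵐ (unit a) (unit b) m) (≡.cong₂ ℤ._+_ (A-unit a m) (A-unit b m))

  A-∸ᵐ : ∀ {u w} → w ∣ᵐ u → ∀ m → (A· u) m ≡ (A· (u ∸ᵐ w)) m ℤ.+ (A· w) m
  A-∸ᵐ w∣u m = Row.L-∸ᵐ m w∣u

  ∼ᴬ-sym : ∀ {u v} → u ∼ᴬ v → v ∼ᴬ u
  ∼ᴬ-sym u∼v m = ≡.sym (u∼v m)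

  ∼ᴬ-trans : ∀ {u v t} → u ∼ᴬ v → v ∼ᴬ t → u ∼ᴬ t
  ∼ᴬ-trans u∼v v∼t m = ≡.trans (u∼v m) (v∼t m)

  ∼ᴬ-·ᵐ : ∀ t {u v} → u ∼ᴬ v → t ·ᵐ u ∼ᴬ t ·ᵐ v
  ∼ᴬ-·ᵐ t {u} {v} u∼v m = begin
    (A· (t ·ᵐ u)) m          ≡⟨ A-·ᵐ t u m ⟩
    (A· t) m ℤ.+ (A· u) m    ≡⟨ cong (ℤ._+_ ((A· t) m)) (u∼v m) ⟩
    (A· t) m ℤ.+ (A· v) m    ≡⟨ A-·ᵐ t v m ⟨
    (A· (t ·ᵐ v)) m          ∎
    where open ≡.≡-Reasoning

  ∼ᴬ-∸ᵐ : ∀ {u v w} → w ∣ᵐ u → w ∣ᵐ v → u ∼ᴬ v → u ∸ᵐ w ∼ᴬ v ∸ᵐ w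
  ∼ᴬ-∸ᵐ {u} {v} {w} w∣u w∣v u∼v m = ∙-cancelʳ _ _ _ (begin
    (A· (u ∸ᵐ w)) m ℤ.+ (A· w) m    ≡⟨ A-∸ᵐ w∣u m ⟨
    (A· u) m                        ≡⟨ u∼v m ⟩
    (A· v) m                        ≡⟨ A-∸ᵐ w∣v m ⟩
    (A· (v ∸ᵐ w)) m ℤ.+ (A· w) m    ∎)
    where open ≡.≡-Reasoning

  δ : Fin d → Fin d → ℤ
  δ m i = if ⌊ m Fin.≟ i ⌋ then + 1 else + 0

  incidence-δ : ∀ m {i j} (p : i Fin.< j) → incidence m (arc i j p) ≡ δ m i - δ m j
  incidence-δ m {i} {j} p with m Fin.≟ i | m Fin.≟ j
  ... | yes refl | yes refl = ⊥-elim (Finₚ.<-irrefl refl p)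
  ... | yes _    | no _     = refl
  ... | no _     | yes _    = refl
  ... | no _     | no _     = refl

  incidence-src : ∀ {i k : Fin d} .(p : i Fin.< k) → incidence i (arc i k p) ≡ + 1
  incidence-src {i} p with i Fin.≟ i
  ... | yes _   = refl
  ... | no i≢i  = ⊥-elim (i≢i refl)

  incidence-tgt : ∀ {i k : Fin d} (p : i Fin.< k) → incidence k (arc i k p) ≡ - + 1
  incidence-tgt {i} {k} p with k Fin.≟ i | k Fin.≟ k
  ... | yes refl | _       = ⊥-elim (Finₚ.<-irrefl refl p)
  ... | no _     | yes _   = refl
  ... | no _     | no k≢k  = ⊥-elim (k≢k refl)

  private
    module ℤSum = ArcSum ℤₚ.+-0-commutativeMonoid {d}

  A-nonpos : ∀ u m → (∀ e → Var.src e ≡ m → u e ≡ 0) → (A· u) m ℤ.≤ + 0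
  A-nonpos u m no-out =
    ℤSum.sumVar-closed (ℤ._≤ + 0) (λ { refl x≤0 → x≤0 }) ℤₚ.≤-refl ℤₚ.+-mono-≤ _ term-nonpos
    where
    term-nonpos : ∀ e → incidence m e ℤ.* + u e ℤ.≤ + 0
    term-nonpos e@(arc i j _) with m Fin.≟ i
    ... | yes refl rewrite no-out e refl = ℤₚ.≤-refl
    ... | no _ with m Fin.≟ j
    ...   | yes _ = ≡.subst (ℤ._≤ + 0) (≡.sym (ℤₚ.-1*i≡-i (+ u e))) ℤₚ.neg-≤-pos
    ...   | no _  = ℤₚ.≤-refl

  A-nonneg : ∀ u m → (∀ e → Var.tgt e ≡ m → u e ≡ 0) → + 0 ℤ.≤ (A· u) m
  A-nonneg u m no-in =
    ℤSum.sumVar-closed (+ 0 ℤ.≤_) (λ { refl 0≤x → 0≤x }) ℤₚ.≤-refl ℤₚ.+-mono-≤ _ term-nonneg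
    where
    term-nonneg : ∀ e → + 0 ℤ.≤ incidence m e ℤ.* + u e
    term-nonneg e@(arc i j _) with m Fin.≟ i
    ... | yes _ = ≡.subst (+ 0 ℤ.≤_) (≡.sym (ℤₚ.*-identityˡ (+ u e))) (ℤ.+≤+ z≤n)
    ... | no _ with m Fin.≟ j
    ...   | yes refl rewrite no-in e refl = ℤₚ.≤-refl
    ...   | no _  = ℤₚ.≤-refl

rank-path : ∀ {i j} k → i ℕ.≤ j → ℕ.suc (i ℕ.* k) ℕ.< ℕ.suc (i ℕ.* j) ℕ.+ ℕ.suc (j ℕ.* k)
rank-path {i} {j} k i≤j = begin-strict
  ℕ.suc (i ℕ.* k)                     ≤⟨ s≤s (ℕₚ.*-monoˡ-≤ k i≤j) ⟩
  ℕ.suc (j ℕ.* k)                     <⟨ ℕₚ.m<n+m _ (s≤s z≤n) ⟩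
  ℕ.suc (i ℕ.* j) ℕ.+ ℕ.suc (j ℕ.* k) ∎
  where open ℕₚ.≤-Reasoning

rank-cross : ∀ {i j k l} → i ℕ.< j → k ℕ.< l →
             ℕ.suc (i ℕ.* l) ℕ.+ ℕ.suc (j ℕ.* k) ℕ.< ℕ.suc (i ℕ.* k) ℕ.+ ℕ.suc (j ℕ.* l)
rank-cross {i} {j} {k} {l} i<j k<l =
  ≡.subst₂ (λ j l → ℕ.suc (i ℕ.* l) ℕ.+ ℕ.suc (j ℕ.* k) ℕ.< ℕ.suc (i ℕ.* k) ℕ.+ ℕ.suc (j ℕ.* l))
           (ℕₚ.m+[n∸m]≡n (ℕₚ.<⇒≤ i<j)) (ℕₚ.m+[n∸m]≡n (ℕₚ.<⇒≤ k<l))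
           (shifted (ℕₚ.*-mono-≤ (ℕₚ.m<n⇒0<n∸m i<j) (ℕₚ.m<n⇒0<n∸m k<l)))
  where
  -- with j = i + s and l = k + t the two sides differ by s t
  gap : ∀ i k s t → ℕ.suc (i ℕ.* (k ℕ.+ t)) ℕ.+ ℕ.suc ((i ℕ.+ s) ℕ.* k) ℕ.+ s ℕ.* t
                    ≡ ℕ.suc (i ℕ.* k) ℕ.+ ℕ.suc ((i ℕ.+ s) ℕ.* (k ℕ.+ t))
  gap = ℕ-Solver.solve-∀
  shifted : ∀ {s t} → 0 ℕ.< s ℕ.* t →
            ℕ.suc (i ℕ.* (k ℕ.+ t)) ℕ.+ ℕ.suc ((i ℕ.+ s) ℕ.* k) ℕ.< ℕ.suc (i ℕ.* k) ℕ.+ ℕ.suc ((i ℕ.+ s) ℕ.* (k ℕ.+ t))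
  shifted {s} {t} st>0 =
    ≡.subst (ℕ.suc (i ℕ.* (k ℕ.+ t)) ℕ.+ ℕ.suc ((i ℕ.+ s) ℕ.* k) ℕ.<_) (gap i k s t) (ℕₚ.m<m+n _ st>0)

module _ {d : ℕ} where

  μ : Var d → ℕ
  μ (arc i j _) = ℕ.suc (Fin.toℕ i ℕ.* Fin.toℕ j)

  private
    module Rank = Linear ℕₚ.+-0-commutativeMonoid (λ e n → μ e ℕ.* n)
                    (λ e → ℕₚ.*-distribˡ-+ (μ e)) (λ e → ℕₚ.*-zeroʳ (μ e))

  rank : Monomial d → ℕ
  rank = Rank.L

  rank-unit : ∀ a → rank (unit a) ≡ μ a
  rank-unit a = ≡.trans (Rank.L-unit a) (ℕₚ.*-identityʳ (μ a))

  rank-·ᵐ : ∀ u v → rank (u ·ᵐ v) ≡ rank u ℕ.+ rank v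
  rank-·ᵐ = Rank.L-·

  rank-unit·unit : ∀ a b → rank (unit a ·ᵐ unit b) ≡ μ a ℕ.+ μ b
  rank-unit·unit a b = ≡.trans (rank-·ᵐ (unit a) (unit b)) (≡.cong₂ ℕ._+_ (rank-unit a) (rank-unit b))

  rank-∸ᵐ : ∀ {u w} → w ∣ᵐ u → rank u ≡ rank (u ∸ᵐ w) ℕ.+ rank w
  rank-∸ᵐ = Rank.L-∸ᵐ

least-witness : ∀ {n p} {P : Pred (Fin n) p} → Decidable P → ∃ P →
                ∃ λ k → P k × (∀ {m} → m Fin.< k → ¬ P m)
least-witness {ℕ.suc n} P? (x , px) with P? zero
... | yes p₀ = zero , p₀ , λ ()
... | no ¬p₀ with x
...   | zero   = ⊥-elim (¬p₀ px)
...   | suc x′ with least-witness (P? ∘ suc) (x′ , px)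
...     | k , pk , below = suc k , pk , λ { {zero} _ → ¬p₀ ; {suc m} (s≤s m<k) → below m<k }

greatest-witness : ∀ {n p} {P : Pred (Fin n) p} → Decidable P → ∃ P →
                   ∃ λ k → P k × (∀ {m} → k Fin.< m → ¬ P m)
greatest-witness {ℕ.suc n} P? (x , px) with any? (P? ∘ suc)
... | yes later with greatest-witness (P? ∘ suc) later
...   | k , pk , above = suc k , pk , λ { {suc m} (s≤s k<m) → above k<m }
greatest-witness {ℕ.suc n} P? (zero , p₀)   | no none = zero , p₀ , λ { {suc m} _ → none ∘ (m ,_) }
greatest-witness {ℕ.suc n} P? (suc x′ , px) | no none = ⊥-elim (none (x′ , px))

-- Standard monomials

module _ {d : ℕ} where

  open import Data.Integer.Base using (-_; _-_)

  -- the pairs of arcs {a, b} whose product x_a x_b is a leading monomial of the basis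
  data Obstruction : Var d → Var d → Set where
    path  : ∀ {i j k} (p : i Fin.< j) (q : j Fin.< k) → Obstruction (arc i j p) (arc j k q)
    cross : ∀ {i j k l} (p : i Fin.< j) (q : j Fin.< k) (r : k Fin.< l) →
            Obstruction (arc i k (Finₚ.<-trans p q)) (arc j l (Finₚ.<-trans q r))

  trailing : ∀ {a b} → Obstruction a b → Monomial d
  trailing (path {i} {j} {k} p q)        = unit (arc i k (Finₚ.<-trans p q))
  trailing (cross {i} {j} {k} {l} p q r) = unit (arc i l (Finₚ.<-trans p (Finₚ.<-trans q r))) ·ᵐ unit (arc j k q)

  obstruction-≢ : ∀ {a b} → Obstruction a b → a ≢ b
  obstruction-≢ (path p q)    a≡b = Finₚ.<-irrefl (cong Var.src a≡b) p
  obstruction-≢ (cross p q r) a≡b = Finₚ.<-irrefl (cong Var.src a≡b) p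

  Nonstandard : Monomial d → Set
  Nonstandard u = Σ[ a ∈ Var d ] Σ[ b ∈ Var d ] (Obstruction a b × a ∈ᵐ u × b ∈ᵐ u)

  Standard : Monomial d → Set
  Standard u = ¬ Nonstandard u

  Standard-∣ᵐ : ∀ {u v} → v ∣ᵐ u → Standard u → Standard v
  Standard-∣ᵐ v∣u std (a , b , o , a∈v , b∈v) = std (a , b , o , ∈ᵐ-∣ᵐ a∈v v∣u , ∈ᵐ-∣ᵐ b∈v v∣u)

  ∈ᵐ-unit·unit-both : ∀ {a b c c′ : Var d} → a ∈ᵐ unit c ·ᵐ unit c′ → b ∈ᵐ unit c ·ᵐ unit c′ → a ≢ b →
                      (a ≡ c × b ≡ c′) ⊎ (a ≡ c′ × b ≡ c)
  ∈ᵐ-unit·unit-both {a} {b} {c} {c′} a∈ b∈ a≢b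
    with ∈ᵐ-unit·unit {e = a} {c} {c′} a∈ | ∈ᵐ-unit·unit {e = b} {c} {c′} b∈
  ... | inj₁ refl | inj₁ refl = ⊥-elim (a≢b refl)
  ... | inj₁ refl | inj₂ refl = inj₁ (refl , refl)
  ... | inj₂ refl | inj₁ refl = inj₂ (refl , refl)
  ... | inj₂ refl | inj₂ refl = ⊥-elim (a≢b refl)

  private
    _∈ᵐ?_ : ∀ (a : Var d) u → Dec (a ∈ᵐ u)
    a ∈ᵐ? u = 1 ℕₚ.≤? u a

    Σ<? : ∀ {i j : Fin d} {B : i Fin.< j → Set} → (∀ p → Dec (B p)) → Dec (Σ (i Fin.< j) B)
    Σ<? {i} {j} {B} B? with i <? j
    ... | no i≮j = no (i≮j ∘ proj₁)
    ... | yes p with B? p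
    ...   | yes b  = yes (p , b)
    ...   | no ¬b  = no λ { (p′ , b) → ¬b (≡.subst B (Finₚ.<-irrelevant p′ p) b) }

  nonstandard? : ∀ u → Dec (Nonstandard u)
  nonstandard? u = map′ found forget (paths? ⊎-dec crosses?)
    where
    Paths Crosses : Set
    Paths = ∃ λ i → ∃ λ j → ∃ λ k → Σ (i Fin.< j) λ p → Σ (j Fin.< k) λ q →
              arc i j p ∈ᵐ u × arc j k q ∈ᵐ u
    Crosses = ∃ λ i → ∃ λ j → ∃ λ k → ∃ λ l → Σ (i Fin.< j) λ p → Σ (j Fin.< k) λ q → Σ (k Fin.< l) λ r →
                arc i k (Finₚ.<-trans p q) ∈ᵐ u × arc j l (Finₚ.<-trans q r) ∈ᵐ u
    paths? : Dec Paths
    paths? = any? λ i → any? λ j → any? λ k → Σ<? λ p → Σ<? λ q →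
               (arc i j p ∈ᵐ? u) ×-dec (arc j k q ∈ᵐ? u)
    crosses? : Dec Crosses
    crosses? = any? λ i → any? λ j → any? λ k → any? λ l → Σ<? λ p → Σ<? λ q → Σ<? λ r →
                 (arc i k (Finₚ.<-trans p q) ∈ᵐ? u) ×-dec (arc j l (Finₚ.<-trans q r) ∈ᵐ? u)
    found : Paths ⊎ Crosses → Nonstandard u
    found (inj₁ (_ , _ , _ , p , q , a∈ , b∈))         = _ , _ , path p q , a∈ , b∈
    found (inj₂ (_ , _ , _ , _ , p , q , r , a∈ , b∈)) = _ , _ , cross p q r , a∈ , b∈
    forget : Nonstandard u → Paths ⊎ Crosses
    forget (_ , _ , path p q , a∈ , b∈)    = inj₁ (_ , _ , _ , p , q , a∈ , b∈)
    forget (_ , _ , cross p q r , a∈ , b∈) = inj₂ (_ , _ , _ , _ , p , q , r , a∈ , b∈)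

  unit-standard : ∀ c → Standard (unit c)
  unit-standard c (a , b , o , a∈ , b∈) =
    obstruction-≢ o (≡.trans (∈ᵐ-unit {a = c} a∈) (≡.sym (∈ᵐ-unit {a = c} b∈)))

  trailing-standard : ∀ {a b} (o : Obstruction a b) → Standard (trailing o)
  trailing-standard (path {i} {j} {k} p q) = unit-standard (arc i k (Finₚ.<-trans p q))
  trailing-standard (cross {i} {j} {k} {l} p q r) (a , b , o , a∈ , b∈)
    with ∈ᵐ-unit·unit-both {c = arc i l (Finₚ.<-trans p (Finₚ.<-trans q r))} {c′ = arc j k q}
                           a∈ b∈ (obstruction-≢ o)
  ... | inj₁ (refl , refl) = outer-inner q r o
    where
    outer-inner : ∀ {i j k l} .{il : i Fin.< l} .{jk : j Fin.< k} →
                  j Fin.< k → k Fin.< l → Obstruction (arc i l il) (arc j k jk) → ⊥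
    outer-inner j<k k<l (path _ _)      = Finₚ.<-asym j<k k<l
    outer-inner j<k k<l (cross _ _ l<k) = Finₚ.<-asym k<l l<k
  ... | inj₂ (refl , refl) = inner-outer p (Finₚ.<-trans p q) o
    where
    inner-outer : ∀ {i j k l} .{il : i Fin.< l} .{jk : j Fin.< k} →
                  i Fin.< j → i Fin.< k → Obstruction (arc j k jk) (arc i l il) → ⊥
    inner-outer i<j i<k (path _ _)      = Finₚ.<-irrefl refl i<k
    inner-outer i<j i<k (cross j<i _ _) = Finₚ.<-asym i<j j<i

  trailing-∼ᴬ : ∀ {a b} (o : Obstruction a b) → unit a ·ᵐ unit b ∼ᴬ trailing o
  trailing-∼ᴬ (path {i} {j} {k} p q) m = begin
    (A· (unit (arc i j p) ·ᵐ unit (arc j k q))) m        ≡⟨ A-unit·unit (arc i j p) (arc j k q) m ⟩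
    incidence m (arc i j p) ℤ.+ incidence m (arc j k q)   ≡⟨ ≡.cong₂ ℤ._+_ (incidence-δ m p) (incidence-δ m q) ⟩
    (δ m i - δ m j) ℤ.+ (δ m j - δ m k)                   ≡⟨ telescope (δ m i) (δ m j) (δ m k) ⟩
    δ m i - δ m k                                         ≡⟨ incidence-δ m ik ⟨
    incidence m (arc i k ik)                              ≡⟨ A-unit (arc i k ik) m ⟨
    (A· unit (arc i k ik)) m                              ∎
    where
    open ≡.≡-Reasoning
    ik = Finₚ.<-trans p q
    telescope : ∀ x y z → (x - y) ℤ.+ (y - z) ≡ x - z
    telescope = ℤ-Solver.solve-∀
  trailing-∼ᴬ (cross {i} {j} {k} {l} p q r) m = begin
    (A· (unit (arc i k ik) ·ᵐ unit (arc j l jl))) m          ≡⟨ A-unit·unit (arc i k ik) (arc j l jl) m ⟩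
    incidence m (arc i k ik) ℤ.+ incidence m (arc j l jl)     ≡⟨ ≡.cong₂ ℤ._+_ (incidence-δ m ik) (incidence-δ m jl) ⟩
    (δ m i - δ m k) ℤ.+ (δ m j - δ m l)                       ≡⟨ swap (δ m i) (δ m j) (δ m k) (δ m l) ⟩
    (δ m i - δ m l) ℤ.+ (δ m j - δ m k)                       ≡⟨ ≡.cong₂ ℤ._+_ (incidence-δ m il) (incidence-δ m q) ⟨
    incidence m (arc i l il) ℤ.+ incidence m (arc j k q)      ≡⟨ A-unit·unit (arc i l il) (arc j k q) m ⟨
    (A· (unit (arc i l il) ·ᵐ unit (arc j k q))) m           ∎
    where
    open ≡.≡-Reasoning
    ik = Finₚ.<-trans p q
    jl = Finₚ.<-trans q r
    il = Finₚ.<-trans p jl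
    swap : ∀ x y z w → (x - z) ℤ.+ (y - w) ≡ (x - w) ℤ.+ (y - z)
    swap = ℤ-Solver.solve-∀

  trailing-rank : ∀ {a b} (o : Obstruction a b) → rank (trailing o) ℕ.< rank (unit a ·ᵐ unit b)
  trailing-rank (path {i} {j} {k} p q) =
    ≡.subst₂ ℕ._<_ (≡.sym (rank-unit (arc i k (Finₚ.<-trans p q))))
                   (≡.sym (rank-unit·unit (arc i j p) (arc j k q)))
                   (rank-path _ (ℕₚ.<⇒≤ p))
  trailing-rank (cross {i} {j} {k} {l} p q r) =
    ≡.subst₂ ℕ._<_ (≡.sym (rank-unit·unit (arc i l (Finₚ.<-trans p (Finₚ.<-trans q r))) (arc j k q)))
                   (≡.sym (rank-unit·unit (arc i k (Finₚ.<-trans p q)) (arc j l (Finₚ.<-trans q r))))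
                   (rank-cross p r)

  -- vertices with net in-flow and net out-flow in the A-degree of u
  Sink Source : Monomial d → Fin d → Set
  Sink u m   = (A· u) m ℤ.< + 0
  Source u m = + 0 ℤ.< (A· u) m

  standard-sink : ∀ {u} → Standard u → ∀ a → a ∈ᵐ u → Sink u (Var.tgt a)
  standard-sink {u} std a@(arc i k p) a∈u = ≡.subst (ℤ._< + 0) (≡.sym (A-∸ᵐ (unit-∣ᵐ a∈u) k)) (begin-strict
    (A· (u ∸ᵐ unit a)) k ℤ.+ (A· unit a) k   ≡⟨ cong (ℤ._+_ ((A· (u ∸ᵐ unit a)) k)) (≡.trans (A-unit a k) (incidence-tgt p′)) ⟩
    (A· (u ∸ᵐ unit a)) k ℤ.+ - + 1           <⟨ ℤₚ.+-mono-≤-< (A-nonpos (u ∸ᵐ unit a) k no-out) (ℤ.-<+ {0} {0}) ⟩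
    + 0                                      ∎)
    where
    open ℤₚ.≤-Reasoning
    p′ = recompute (i <? k) p
    no-out : ∀ e → Var.src e ≡ k → (u ∸ᵐ unit a) e ≡ 0
    no-out e@(arc _ l q) refl =
      ∉ᵐ-∣ᵐ (∸ᵐ-∣ᵐ u (unit a)) λ e∈u → std (_ , _ , path p′ (recompute (k <? l) q) , a∈u , e∈u)

  standard-source : ∀ {u} → Standard u → ∀ a → a ∈ᵐ u → Source u (Var.src a)
  standard-source {u} std a@(arc i k p) a∈u = ≡.subst (+ 0 ℤ.<_) (≡.sym (A-∸ᵐ (unit-∣ᵐ a∈u) i)) (begin-strict
    + 0                                      <⟨ ℤₚ.+-mono-≤-< (A-nonneg (u ∸ᵐ unit a) i no-in) (ℤ.+<+ {0} {1} (s≤s z≤n)) ⟩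
    (A· (u ∸ᵐ unit a)) i ℤ.+ + 1             ≡⟨ cong (ℤ._+_ ((A· (u ∸ᵐ unit a)) i)) (≡.trans (A-unit a i) (incidence-src p)) ⟨
    (A· (u ∸ᵐ unit a)) i ℤ.+ (A· unit a) i   ∎)
    where
    open ℤₚ.≤-Reasoning
    no-in : ∀ e → Var.tgt e ≡ i → (u ∸ᵐ unit a) e ≡ 0
    no-in e@(arc h _ q) refl =
      ∉ᵐ-∣ᵐ (∸ᵐ-∣ᵐ u (unit a)) λ e∈u → std (_ , _ , path (recompute (h <? i) q) (recompute (i <? k) p) , e∈u , a∈u)

  in-arc : ∀ {u m} → Sink u m → ∃ λ i → Σ (i Fin.< m) λ p → arc i m p ∈ᵐ u
  in-arc {u} {m} sink with any? (λ i → Σ<? λ p → arc i m p ∈ᵐ? u)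
  ... | yes found = found
  ... | no none   = ⊥-elim (ℤₚ.<⇒≱ sink (A-nonneg u m no-in))
    where
    no-in : ∀ e → Var.tgt e ≡ m → u e ≡ 0
    no-in (arc i _ p) refl = ∉ᵐ⇒0 {u = u} λ e∈u → none (i , recompute (i <? m) p , e∈u)

  out-arc : ∀ {u m} → Source u m → ∃ λ l → Σ (m Fin.< l) λ p → arc m l p ∈ᵐ u
  out-arc {u} {m} source with any? (λ l → Σ<? λ p → arc m l p ∈ᵐ? u)
  ... | yes found = found
  ... | no none   = ⊥-elim (ℤₚ.<⇒≱ source (A-nonpos u m no-out))
    where
    no-out : ∀ e → Var.src e ≡ m → u e ≡ 0
    no-out (arc _ l p) refl = ∉ᵐ⇒0 {u = u} λ e∈u → none (l , recompute (m <? l) p , e∈u)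

  -- In a standard monomial the leftmost sink k is entered from the nearest source i* to its left:
  -- an arc into k from further left together with the arc leaving i* would form a cross.
  leftmost-arc : ∀ {u w} → Standard w → w ∼ᴬ u → ∀ {i* k} (i*<k : i* Fin.< k) →
                 Sink u k → (∀ {m} → m Fin.< k → ¬ Sink u m) →
                 Source u i* → (∀ {m} → i* Fin.< m → ¬ (m Fin.< k × Source u m)) →
                 arc i* k i*<k ∈ᵐ w
  leftmost-arc {u} {w} std w∼u {i*} {k} i*<k sink-k k-least source-i* i*-greatest
    with in-arc {w} (≡.subst (ℤ._< + 0) (≡.sym (w∼u k)) sink-k)
       | out-arc {w} (≡.subst (+ 0 ℤ.<_) (≡.sym (w∼u i*)) source-i*)
  ... | i , i<k , ik∈w | l , i*<l , i*l∈w with l Fin.≟ k | i Fin.≟ i*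
  ...   | yes refl | _        = i*l∈w
  ...   | no _     | yes refl = ik∈w
  ...   | no l≢k   | no i≢i*  = ⊥-elim (std (_ , _ , cross i<i* i*<k k<l , ik∈w , i*l∈w))
    where
    sink-l : Sink u l
    sink-l = ≡.subst (ℤ._< + 0) (w∼u l) (standard-sink std _ i*l∈w)
    source-i : Source u i
    source-i = ≡.subst (+ 0 ℤ.<_) (w∼u i) (standard-source std _ ik∈w)
    k<l : k Fin.< l
    k<l = Finₚ.≤∧≢⇒< (ℕₚ.≮⇒≥ λ l<k → k-least l<k sink-l) (l≢k ∘ ≡.sym)
    i<i* : i Fin.< i*
    i<i* = Finₚ.≤∧≢⇒< (ℕₚ.≮⇒≥ λ i*<i → i*-greatest i*<i (i<k , source-i)) i≢i*

  common-arc : ∀ {u v} → Standard u → Standard v → u ∼ᴬ v → ∀ a → a ∈ᵐ u → ∃ λ c → c ∈ᵐ u × c ∈ᵐ v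
  common-arc {u} {v} su sv u∼v a a∈u
    with least-witness (λ m → (A· u) m ℤₚ.<? + 0) (Var.tgt a , standard-sink su a a∈u)
  ... | k , sink-k , k-least with in-arc sink-k
  ...   | i , i<k , ik∈u
    with greatest-witness (λ m → (m <? k) ×-dec (+ 0 ℤₚ.<? (A· u) m))
                          (i , i<k , standard-source su _ ik∈u)
  ...     | i* , (i*<k , source-i*) , i*-greatest =
    arc i* k i*<k ,
    leftmost-arc su (λ _ → refl) i*<k sink-k k-least source-i* i*-greatest ,
    leftmost-arc sv (∼ᴬ-sym u∼v) i*<k sink-k k-least source-i* i*-greatest

  some-arc? : ∀ u → Dec (∃ λ a → a ∈ᵐ u)
  some-arc? u = map′ (λ (i , j , p , a∈u) → arc i j p , a∈u)
                     (λ { (arc i j p , a∈u) → i , j , recompute (i <? j) p , a∈u })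
                     (any? λ i → any? λ j → Σ<? λ p → arc i j p ∈ᵐ? u)

  ∸ᵐ-unit-cancel : ∀ {c : Var d} {u v} → c ∈ᵐ u → c ∈ᵐ v → u ∸ᵐ unit c ≗ᵐ v ∸ᵐ unit c → u ≗ᵐ v
  ∸ᵐ-unit-cancel {c} {u} {v} c∈u c∈v quotients-equal e = begin
    u e                           ≡⟨ ∸ᵐ-·ᵐ (unit-∣ᵐ {a = c} {u} c∈u) e ⟩
    (u ∸ᵐ unit c) e ℕ.+ unit c e  ≡⟨ cong (ℕ._+ unit c e) (quotients-equal e) ⟩
    (v ∸ᵐ unit c) e ℕ.+ unit c e  ≡⟨ ∸ᵐ-·ᵐ (unit-∣ᵐ {a = c} {v} c∈v) e ⟨
    v e                           ∎
    where open ≡.≡-Reasoning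

  rank-∸ᵐ-unit : ∀ {c : Var d} {u} → c ∈ᵐ u → rank (u ∸ᵐ unit c) ℕ.< rank u
  rank-∸ᵐ-unit {c} {u} c∈u = ≡.subst (rank (u ∸ᵐ unit c) ℕ.<_)
    (≡.sym (≡.trans (rank-∸ᵐ (unit-∣ᵐ {a = c} {u} c∈u)) (cong (rank (u ∸ᵐ unit c) ℕ.+_) (rank-unit c))))
    (ℕₚ.m<m+n _ (s≤s z≤n))

  arc-free-unique : ∀ {u v : Monomial d} → ¬ (∃ λ a → a ∈ᵐ u) → ¬ (∃ λ a → a ∈ᵐ v) → u ≗ᵐ v
  arc-free-unique {u} {v} u-empty v-empty e =
    ≡.trans (∉ᵐ⇒0 {u = u} (u-empty ∘ (e ,_))) (≡.sym (∉ᵐ⇒0 {u = v} (v-empty ∘ (e ,_))))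

  standard-unique : ∀ {u v} → Standard u → Standard v → u ∼ᴬ v → u ≗ᵐ v
  standard-unique {u} = go (<-wellFounded (rank u))
    where
    go : ∀ {u v} → Acc ℕ._<_ (rank u) → Standard u → Standard v → u ∼ᴬ v → u ≗ᵐ v
    go {u} {v} (acc smaller) su sv u∼v = case some-arc? u of λ
      { (yes (a , a∈u)) → case common-arc su sv u∼v a a∈u of λ
          { (c , c∈u , c∈v) →
              ∸ᵐ-unit-cancel {u = u} {v} c∈u c∈v
                (go (smaller (rank-∸ᵐ-unit {u = u} c∈u))
                    (Standard-∣ᵐ (∸ᵐ-∣ᵐ u (unit c)) su) (Standard-∣ᵐ (∸ᵐ-∣ᵐ v (unit c)) sv)
                    (∼ᴬ-∸ᵐ (unit-∣ᵐ c∈u) (unit-∣ᵐ c∈v) u∼v)) }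
      ; (no u-empty) → arc-free-unique {u} {v} u-empty λ (a , a∈v) →
          u-empty (map₂ proj₂ (common-arc sv su (∼ᴬ-sym u∼v) a a∈v)) }

  reduce : ∀ {a b} → Obstruction a b → Monomial d → Monomial d
  reduce {a} {b} o v = v ∸ᵐ (unit a ·ᵐ unit b) ·ᵐ trailing o

  reduce-∼ᴬ : ∀ {a b v} (o : Obstruction a b) → unit a ·ᵐ unit b ∣ᵐ v → reduce o v ∼ᴬ v
  reduce-∼ᴬ {a} {b} {v} o ab∣v =
    ∼ᴬ-trans (∼ᴬ-·ᵐ (v ∸ᵐ (unit a ·ᵐ unit b)) (∼ᴬ-sym (trailing-∼ᴬ o))) (A-cong (≗ᵐ-sym (∸ᵐ-·ᵐ ab∣v)))

  reduce-rank : ∀ {a b v} (o : Obstruction a b) → unit a ·ᵐ unit b ∣ᵐ v → rank (reduce o v) ℕ.< rank v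
  reduce-rank {a} {b} {v} o ab∣v = begin-strict
    rank (reduce o v)                          ≡⟨ rank-·ᵐ (v ∸ᵐ U) (trailing o) ⟩
    rank (v ∸ᵐ U) ℕ.+ rank (trailing o)        <⟨ ℕₚ.+-monoʳ-< (rank (v ∸ᵐ U)) (trailing-rank o) ⟩
    rank (v ∸ᵐ U) ℕ.+ rank U                   ≡⟨ rank-∸ᵐ ab∣v ⟨
    rank v                                     ∎
    where
    open ℕₚ.≤-Reasoning
    U = unit a ·ᵐ unit b

-- Weights

module Weighting {c ℓ ℓ<} (R : OrderedField c ℓ ℓ<) {d : ℕ} (w : Var d → OrderedField.Carrier R) where
  open OrderedField R renaming (refl to ≈-refl)
  open Weights R d using (fromℕ; weight; TriangleCond; QuadCond)
  private
    strictPartialOrder : StrictPartialOrder c ℓ ℓ<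
    strictPartialOrder = record { isStrictPartialOrder = IsStrictTotalOrder.isStrictPartialOrder isStrictTotalOrder }
  open import Relation.Binary.Reasoning.StrictPartialOrder strictPartialOrder

  fromℕ-+ : ∀ m n → fromℕ (m ℕ.+ n) ≈ fromℕ m + fromℕ n
  fromℕ-+ ℕ.zero    n = sym (+-identityˡ (fromℕ n))
  fromℕ-+ (ℕ.suc m) n = trans (+-congˡ (fromℕ-+ m n)) (sym (+-assoc 1# (fromℕ m) (fromℕ n)))

  private
    module W = Linear +-commutativeMonoid (λ e n → w e * fromℕ n)
                 (λ e m n → trans (*-congˡ (fromℕ-+ m n)) (distribˡ (w e) (fromℕ m) (fromℕ n)))
                 (λ e → zeroʳ (w e))

  weight-cong : ∀ {u v} → u ≗ᵐ v → weight w u ≈ weight w v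
  weight-cong = W.L-cong

  weight-unit : ∀ a → weight w (unit a) ≈ w a
  weight-unit a = trans (W.L-unit a) (trans (*-congˡ (+-identityʳ 1#)) (*-identityʳ (w a)))

  weight-unit·unit : ∀ a b → weight w (unit a ·ᵐ unit b) ≈ w a + w b
  weight-unit·unit a b = trans (W.L-· (unit a) (unit b)) (+-cong (weight-unit a) (weight-unit b))

  +-monoˡ-< : ∀ z {x y} → x < y → z + x < z + y
  +-monoˡ-< z {x} {y} x<y = begin-strict
    z + x   ≈⟨ +-comm z x ⟩
    x + z   <⟨ +-mono-< z x<y ⟩
    y + z   ≈⟨ +-comm y z ⟩
    z + y   ∎

  module _ (tri : TriangleCond w) (quad : QuadCond w) where

    trailing-weight : ∀ {a b} (o : Obstruction a b) → weight w (trailing o) < weight w (unit a ·ᵐ unit b)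
    trailing-weight (path {i} {j} {k} p q) = begin-strict
      weight w (unit (arc i k ik))                        ≈⟨ weight-unit (arc i k ik) ⟩
      w (arc i k ik)                                      <⟨ tri i j k p q ⟩
      w (arc i j p) + w (arc j k q)                       ≈⟨ weight-unit·unit (arc i j p) (arc j k q) ⟨
      weight w (unit (arc i j p) ·ᵐ unit (arc j k q))     ∎
      where ik = Finₚ.<-trans p q
    trailing-weight (cross {i} {j} {k} {l} p q r) = begin-strict
      weight w (unit (arc i l il) ·ᵐ unit (arc j k q))    ≈⟨ weight-unit·unit (arc i l il) (arc j k q) ⟩
      w (arc i l il) + w (arc j k q)                      <⟨ quad i j k l p q r ⟩
      w (arc i k ik) + w (arc j l jl)                     ≈⟨ weight-unit·unit (arc i k ik) (arc j l jl) ⟨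
      weight w (unit (arc i k ik) ·ᵐ unit (arc j l jl))   ∎
      where
      ik = Finₚ.<-trans p q
      jl = Finₚ.<-trans q r
      il = Finₚ.<-trans p jl

    reduce-weight : ∀ {a b v} (o : Obstruction a b) → unit a ·ᵐ unit b ∣ᵐ v →
                    weight w (reduce o v) < weight w v
    reduce-weight {a} {b} {v} o ab∣v = begin-strict
      weight w (reduce o v)                            ≈⟨ W.L-· (v ∸ᵐ U) (trailing o) ⟩
      weight w (v ∸ᵐ U) + weight w (trailing o)        <⟨ +-monoˡ-< (weight w (v ∸ᵐ U)) (trailing-weight o) ⟩
      weight w (v ∸ᵐ U) + weight w U                   ≈⟨ W.L-∸ᵐ ab∣v ⟨
      weight w v                                       ∎
      where U = unit a ·ᵐ unit b

    standard-lightest : ∀ {u v} → Standard u → u ∼ᴬ v → ¬ v ≗ᵐ u → weight w u < weight w v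
    standard-lightest {u} {v} su = go (<-wellFounded (rank v))
      where
      go : ∀ {v} → Acc ℕ._<_ (rank v) → u ∼ᴬ v → ¬ v ≗ᵐ u → weight w u < weight w v
      go {v} (acc smaller) u∼v v≉u with nonstandard? v
      ... | no sv = ⊥-elim (v≉u (≗ᵐ-sym (standard-unique su sv u∼v)))
      ... | yes (a , b , o , a∈v , b∈v) = case reduce o v ≟ᵐ u of λ
        { (yes v′≗u) → begin-strict
            weight w u               ≈⟨ weight-cong v′≗u ⟨
            weight w (reduce o v)    <⟨ reduce-weight o ab∣v ⟩
            weight w v               ∎
        ; (no v′≉u) → begin-strict
            weight w u               <⟨ go (smaller (reduce-rank o ab∣v)) (∼ᴬ-trans u∼v (∼ᴬ-sym (reduce-∼ᴬ o ab∣v))) v′≉u ⟩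
            weight w (reduce o v)    <⟨ reduce-weight o ab∣v ⟩
            weight w v               ∎
        }
        where ab∣v = unit·unit-∣ᵐ a∈v b∈v (obstruction-≢ o)

module PolynomialProperties {c ℓ} (K : Field c ℓ) (d : ℕ) where
  open Field K renaming (refl to ≈-refl)
  open Polynomials K d
  open import Algebra.Properties.CommutativeSemigroup +-commutativeSemigroup using (x∙yz≈y∙xz)

  ≈ᴾ-reflexive : ∀ {p q} → p ≡ q → p ≈ᴾ q
  ≈ᴾ-reflexive refl _ = ≈-refl

  ≈ᴾ-sym : ∀ {p q} → p ≈ᴾ q → q ≈ᴾ p
  ≈ᴾ-sym p≈q u = sym (p≈q u)

  ≈ᴾ-trans : ∀ {p q r} → p ≈ᴾ q → q ≈ᴾ r → p ≈ᴾ r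
  ≈ᴾ-trans p≈q q≈r u = trans (p≈q u) (q≈r u)

  coeff-here : ∀ {a v y} p → v ≗ᵐ y → coeff ((a , v) ∷ p) y ≈ a + coeff p y
  coeff-here {v = v} {y} p v≗y with v ≟ᵐ y
  ... | yes _   = ≈-refl
  ... | no v≉y  = ⊥-elim (v≉y v≗y)

  coeff-there : ∀ {a v y} p → ¬ v ≗ᵐ y → coeff ((a , v) ∷ p) y ≈ coeff p y
  coeff-there {v = v} {y} p v≉y with v ≟ᵐ y
  ... | yes v≗y = ⊥-elim (v≉y v≗y)
  ... | no _    = ≈-refl

  ∷-cong : ∀ {a a′ v p q} → a ≈ a′ → p ≈ᴾ q → (a , v) ∷ p ≈ᴾ (a′ , v) ∷ q
  ∷-cong {v = v} a≈a′ p≈q y with v ≟ᵐ y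
  ... | yes _ = +-cong a≈a′ (p≈q y)
  ... | no _  = p≈q y

  InSupp-resp : ∀ {p q u} → p ≈ᴾ q → InSupp q u → InSupp p u
  InSupp-resp {u = u} p≈q u∈q p₀ = u∈q (trans (sym (p≈q u)) p₀)

  IsLeading-resp : ∀ {ℓo} {_>_ : Monomial d → Monomial d → Set ℓo} {p q u} →
                   p ≈ᴾ q → IsLeading _>_ q u → IsLeading _>_ p u
  IsLeading-resp {p = p} {q} p≈q (u∈q , u-max) =
    InSupp-resp {p} {q} p≈q u∈q , λ v v∈p → u-max v (InSupp-resp {q} {p} (≈ᴾ-sym {p} {q} p≈q) v∈p)

  binomial-coeff : ∀ {u v} → ¬ v ≗ᵐ u → coeff (mon u -ᴾ mon v) u ≈ 1#
  binomial-coeff {u} {v} v≉u = begin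
    coeff (mon u -ᴾ mon v) u         ≈⟨ coeff-here ((- 1# , v) ∷ []) (λ _ → refl) ⟩
    1# + coeff ((- 1# , v) ∷ []) u   ≈⟨ +-congˡ (coeff-there [] v≉u) ⟩
    1# + 0#                          ≈⟨ +-identityʳ 1# ⟩
    1#                               ∎
    where open import Relation.Binary.Reasoning.Setoid setoid

  binomial-support : ∀ {u v y} → InSupp (mon u -ᴾ mon v) y → y ≗ᵐ u ⊎ y ≗ᵐ v
  binomial-support {u} {v} {y} y∈ with u ≟ᵐ y
  ... | yes u≗y = inj₁ (≗ᵐ-sym u≗y)
  ... | no u≉y with v ≟ᵐ y
  ...   | yes v≗y = inj₂ (≗ᵐ-sym v≗y)
  ...   | no _    = ⊥-elim (y∈ ≈-refl)

  binomial-∈I-A : ∀ {u v} → u ∼ᴬ v → I-A (mon u -ᴾ mon v)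
  binomial-∈I-A {u} {v} u∼v =
    (mon 1ᵐ , mon u -ᴾ mon v , u , v , u∼v , refl) ∷ [] ,
    ∷-cong (sym (*-identityˡ 1#)) (∷-cong (sym (*-identityˡ (- 1#))) λ _ → ≈-refl)

  -- the component of q in the A-degree of u, evaluated at 1
  fibreSum : Monomial d → Poly → Carrier
  fibreSum u []            = 0#
  fibreSum u ((a , v) ∷ q) with u ∼ᴬ? v
  ... | yes _ = a + fibreSum u q
  ... | no _  = fibreSum u q

  fibreSum-++ : ∀ u p q → fibreSum u (p ++ q) ≈ fibreSum u p + fibreSum u q
  fibreSum-++ u []            q = sym (+-identityˡ _)
  fibreSum-++ u ((a , v) ∷ p) q with u ∼ᴬ? v
  ... | yes _ = trans (+-congˡ (fibreSum-++ u p q)) (sym (+-assoc _ _ _))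
  ... | no _  = fibreSum-++ u p q

  fibreSum-toric : ∀ t h {u v} → u ∼ᴬ v → fibreSum t (h *ᴾ (mon u -ᴾ mon v)) ≈ 0#
  fibreSum-toric t []            u∼v = ≈-refl
  fibreSum-toric t ((a , s) ∷ h) {u} {v} u∼v with t ∼ᴬ? s ·ᵐ u
  ... | yes tu with t ∼ᴬ? s ·ᵐ v
  ...   | yes _  = begin
    a * 1# + (a * - 1# + fibreSum t (h *ᴾ (mon u -ᴾ mon v)))   ≈⟨ +-assoc _ _ _ ⟨
    (a * 1# + a * - 1#) + fibreSum t (h *ᴾ (mon u -ᴾ mon v))   ≈⟨ +-cong cancel (fibreSum-toric t h u∼v) ⟩
    0# + 0#                                                    ≈⟨ +-identityˡ 0# ⟩
    0#                                                         ∎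
    where
    open import Relation.Binary.Reasoning.Setoid setoid
    cancel : a * 1# + a * - 1# ≈ 0#
    cancel = trans (sym (distribˡ a 1# (- 1#))) (trans (*-congˡ (-‿inverseʳ 1#)) (zeroʳ a))
  ...   | no ¬tv = ⊥-elim (¬tv (∼ᴬ-trans tu (∼ᴬ-·ᵐ s u∼v)))
  fibreSum-toric t ((a , s) ∷ h) {u} {v} u∼v | no ¬tu with t ∼ᴬ? s ·ᵐ v
  ...   | yes tv = ⊥-elim (¬tu (∼ᴬ-trans tv (∼ᴬ-·ᵐ s (∼ᴬ-sym u∼v))))
  ...   | no _   = fibreSum-toric t h u∼v

  fibreSum-ideal : ∀ u L → fibreSum u (combo {S = ToricGen} L) ≈ 0#
  fibreSum-ideal u []                                   = ≈-refl
  fibreSum-ideal u ((h , _ , (v , v′ , v∼v′ , refl)) ∷ L) =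
    trans (fibreSum-++ u (h *ᴾ (mon v -ᴾ mon v′)) _)
          (trans (+-cong (fibreSum-toric u h v∼v′) (fibreSum-ideal u L)) (+-identityˡ 0#))

  without : Monomial d → Poly → Poly
  without v []            = []
  without v ((a , s) ∷ q) with s ≟ᵐ v
  ... | yes _ = without v q
  ... | no _  = (a , s) ∷ without v q

  length-without : ∀ v q → length (without v q) ℕ.≤ length q
  length-without v []            = z≤n
  length-without v ((a , s) ∷ q) with s ≟ᵐ v
  ... | yes _ = ℕₚ.m≤n⇒m≤1+n (length-without v q)
  ... | no _  = s≤s (length-without v q)

  coeff-without-other : ∀ {v y} q → ¬ y ≗ᵐ v → coeff (without v q) y ≈ coeff q y
  coeff-without-other                []            y≉v = ≈-refl
  coeff-without-other {v} {y} ((a , s) ∷ q) y≉v with s ≟ᵐ v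
  ... | yes s≗v = trans (coeff-without-other q y≉v)
                        (sym (coeff-there q λ s≗y → y≉v (≗ᵐ-trans (≗ᵐ-sym s≗y) s≗v)))
  ... | no _ with s ≟ᵐ y
  ...   | yes _ = +-congˡ (coeff-without-other q y≉v)
  ...   | no _  = coeff-without-other q y≉v

  coeff-without-same : ∀ {v y} q → y ≗ᵐ v → coeff (without v q) y ≈ 0#
  coeff-without-same                []            y≗v = ≈-refl
  coeff-without-same {v} {y} ((a , s) ∷ q) y≗v with s ≟ᵐ v
  ... | yes _   = coeff-without-same q y≗v
  ... | no s≉v  = trans (coeff-there (without v q) λ s≗y → s≉v (≗ᵐ-trans s≗y y≗v))
                        (coeff-without-same q y≗v)

  fibreSum-without : ∀ {u v} q → u ∼ᴬ v → fibreSum u q ≈ coeff q v + fibreSum u (without v q)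
  fibreSum-without                []            u∼v = sym (+-identityˡ 0#)
  fibreSum-without {u} {v} ((a , s) ∷ q) u∼v with s ≟ᵐ v
  ... | yes s≗v with u ∼ᴬ? s
  ...   | yes _   = trans (+-congˡ (fibreSum-without q u∼v)) (sym (+-assoc _ _ _))
  ...   | no u≁s  = ⊥-elim (u≁s (∼ᴬ-trans u∼v (A-cong (≗ᵐ-sym s≗v))))
  fibreSum-without {u} {v} ((a , s) ∷ q) u∼v | no s≉v with u ∼ᴬ? s
  ...   | yes _ = trans (+-congˡ (fibreSum-without q u∼v)) (x∙yz≈y∙xz a _ _)
  ...   | no _  = fibreSum-without q u∼v

  -- Equality in K need not be decidable, so vanishing of coefficients is only available doubly negated.
  Concentrated : Monomial d → Poly → Set ℓ
  Concentrated u q = ∀ y → u ∼ᴬ y → ¬ y ≗ᵐ u → ¬ ¬ coeff q y ≈ 0#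

  Concentrated-tail : ∀ {u a v} q → (∀ {y} → u ∼ᴬ y → ¬ y ≗ᵐ u → ¬ v ≗ᵐ y) →
                      Concentrated u ((a , v) ∷ q) → Concentrated u q
  Concentrated-tail q v-off conc y u∼y y≉u q-y≉0 =
    conc y u∼y y≉u λ y≈0 → q-y≉0 (trans (sym (coeff-there q (v-off u∼y y≉u))) y≈0)

  fibreSum-concentrated : ∀ {u} q → Concentrated u q → ¬ ¬ fibreSum u q ≈ coeff q u
  fibreSum-concentrated {u} q = go q (<-wellFounded (length q))
    where
    open import Relation.Binary.Reasoning.Setoid setoid
    go : ∀ q → Acc ℕ._<_ (length q) → Concentrated u q → ¬ ¬ fibreSum u q ≈ coeff q u
    go []            _             _    done = done ≈-refl
    go ((a , v) ∷ q) (acc smaller) conc done with u ∼ᴬ? v | v ≟ᵐ u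
    ... | no u≁v  | yes v≗u = u≁v (A-cong (≗ᵐ-sym v≗u))
    ... | no u≁v  | no _    =
      go q (smaller ℕₚ.≤-refl)
         (Concentrated-tail q (λ u∼y _ v≗y → u≁v (∼ᴬ-trans u∼y (A-cong (≗ᵐ-sym v≗y)))) conc) done
    ... | yes _   | yes v≗u =
      go q (smaller ℕₚ.≤-refl)
         (Concentrated-tail q (λ _ y≉u v≗y → y≉u (≗ᵐ-trans (≗ᵐ-sym v≗y) v≗u)) conc)
         (done ∘ +-congˡ)
    ... | yes u∼v | no v≉u  = conc v u∼v v≉u λ v-coeff≈0 →
      go (without v q) (smaller (s≤s (length-without v q))) conc′ λ rest≈ → done (begin
        a + fibreSum u q                                    ≈⟨ +-congˡ (fibreSum-without q u∼v) ⟩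
        a + (coeff q v + fibreSum u (without v q))          ≈⟨ +-assoc _ _ _ ⟨
        (a + coeff q v) + fibreSum u (without v q)          ≈⟨ +-congʳ (coeff-here q λ _ → refl) ⟨
        coeff ((a , v) ∷ q) v + fibreSum u (without v q)    ≈⟨ +-congʳ v-coeff≈0 ⟩
        0# + fibreSum u (without v q)                       ≈⟨ +-identityˡ _ ⟩
        fibreSum u (without v q)                            ≈⟨ rest≈ ⟩
        coeff (without v q) u                               ≈⟨ coeff-without-other q (v≉u ∘ ≗ᵐ-sym) ⟩
        coeff q u                                           ∎)
      where
      conc′ : Concentrated u (without v q)
      conc′ y u∼y y≉u with y ≟ᵐ v
      ... | yes y≗v = λ y≉0 → y≉0 (coeff-without-same q y≗v)
      ... | no y≉v  = λ y≉0 → conc y u∼y y≉u λ y≈0 →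
        y≉0 (trans (coeff-without-other q y≉v) (trans (sym (coeff-there q (y≉v ∘ ≗ᵐ-sym))) y≈0))

-- The reduced Gröbner basis

module ReducedBasis {c ℓ} (K : Field c ℓ) {c′ ℓ′ ℓ<} (R : OrderedField c′ ℓ′ ℓ<)
                    (d : ℕ) {ℓo} (T : TermOrder d ℓo) (w : Var d → OrderedField.Carrier R)
                    (tri : Weights.TriangleCond R d w) (quad : Weights.QuadCond R d w) where
  open Polynomials K d
  open PolynomialProperties K d
  open Weights R d using (weight; refine)
  open Weighting R w using (weight-cong; trailing-weight; standard-lightest)
  private
    module K = Field K
    module R = OrderedField R
    module <ᴿ = IsStrictTotalOrder R.isStrictTotalOrder

  -- All comparisons below are decided by the weight alone: the term order T only breaks ties.
  _≻_ : Monomial d → Monomial d → Set (ℓ′ ⊔ ℓ< ⊔ ℓo)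
  _≻_ = refine w (TermOrder._≻_ T)

  heavier⇒⊁ : ∀ {u v} → weight w u R.< weight w v → ¬ u ≻ v
  heavier⇒⊁ u<v (inj₁ v<u)        = <ᴿ.asym u<v v<u
  heavier⇒⊁ u<v (inj₂ (u≈v , _)) = <ᴿ.irrefl u≈v u<v

  module _ {u v} (v<u : weight w v R.< weight w u) where

    lighter-≉ : ¬ v ≗ᵐ u
    lighter-≉ v≗u = <ᴿ.irrefl (weight-cong v≗u) v<u

    binomial-leading : IsLeading _≻_ (mon u -ᴾ mon v) u
    binomial-leading = u∈ , u-max
      where
      u∈ : InSupp (mon u -ᴾ mon v) u
      u∈ u≈0 = K.1≉0 (K.trans (K.sym (binomial-coeff lighter-≉)) u≈0)
      u-max : ∀ y → InSupp (mon u -ᴾ mon v) y → ¬ y ≗ᵐ u → u ≻ y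
      u-max y y∈ y≉u with binomial-support y∈
      ... | inj₁ y≗u = ⊥-elim (y≉u y≗u)
      ... | inj₂ y≗v = inj₁ (<ᴿ.<-respˡ-≈ (R.sym (weight-cong y≗v)) v<u)

    binomial-leading-unique : ∀ {y} → IsLeading _≻_ (mon u -ᴾ mon v) y → y ≗ᵐ u
    binomial-leading-unique (y∈ , y-max) with binomial-support y∈
    ... | inj₁ y≗u = y≗u
    ... | inj₂ y≗v = ⊥-elim (heavier⇒⊁ (<ᴿ.<-respˡ-≈ (R.sym (weight-cong y≗v)) v<u)
                                        (y-max u (proj₁ binomial-leading) λ u≗y → lighter-≉ (≗ᵐ-sym (≗ᵐ-trans u≗y y≗v))))

  basisPoly : ∀ {a b} → Obstruction a b → Poly
  basisPoly (path {i} {j} {k} p q) =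
    x (arc i j p) *ᴾ x (arc j k q) -ᴾ x (arc i k (Finₚ.<-trans p q))
  basisPoly (cross {i} {j} {k} {l} p q r) =
    x (arc i k (Finₚ.<-trans p q)) *ᴾ x (arc j l (Finₚ.<-trans q r))
      -ᴾ x (arc i l (Finₚ.<-trans p (Finₚ.<-trans q r))) *ᴾ x (arc j k q)

  basisPoly-∈ : ∀ {a b} (o : Obstruction a b) → GdBasis (basisPoly o)
  basisPoly-∈ (path p q)    = inj₁ (_ , _ , _ , p , q , refl)
  basisPoly-∈ (cross p q r) = inj₂ (_ , _ , _ , _ , p , q , r , refl)

  GdBasis⇒basisPoly : ∀ {g} → GdBasis g → ∃ λ a → ∃ λ b → Σ (Obstruction a b) λ o → g ≡ basisPoly o
  GdBasis⇒basisPoly (inj₁ (_ , _ , _ , p , q , refl))         = _ , _ , path p q , refl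
  GdBasis⇒basisPoly (inj₂ (_ , _ , _ , _ , p , q , r , refl)) = _ , _ , cross p q r , refl

  binomialOf : ∀ {a b} → Obstruction a b → Poly
  binomialOf {a} {b} o = mon (unit a ·ᵐ unit b) -ᴾ mon (trailing o)

  basisPoly≈binomial : ∀ {a b} (o : Obstruction a b) → basisPoly o ≈ᴾ binomialOf o
  basisPoly≈binomial (path p q)    = ∷-cong (K.*-identityˡ K.1#) λ _ → K.refl
  basisPoly≈binomial (cross p q r) = ∷-cong (K.*-identityˡ K.1#) (∷-cong (K.-‿cong (K.*-identityˡ K.1#)) λ _ → K.refl)

  basisPoly-leading : ∀ {a b} (o : Obstruction a b) → IsLeading _≻_ (basisPoly o) (unit a ·ᵐ unit b)
  basisPoly-leading o =
    IsLeading-resp {_>_ = _≻_} {basisPoly o} {binomialOf o} (basisPoly≈binomial o) (binomial-leading (trailing-weight tri quad o))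

  basisPoly-leading-unique : ∀ {a b y} (o : Obstruction a b) → IsLeading _≻_ (basisPoly o) y → y ≗ᵐ unit a ·ᵐ unit b
  basisPoly-leading-unique o y-lead =
    binomial-leading-unique (trailing-weight tri quad o)
      (IsLeading-resp {_>_ = _≻_} {binomialOf o} {basisPoly o} (≈ᴾ-sym {basisPoly o} {binomialOf o} (basisPoly≈binomial o)) y-lead)

  basisPoly-support : ∀ {a b y} (o : Obstruction a b) → InSupp (basisPoly o) y → y ≗ᵐ unit a ·ᵐ unit b ⊎ y ≗ᵐ trailing o
  basisPoly-support o y∈ =
    binomial-support (InSupp-resp {binomialOf o} {basisPoly o} (≈ᴾ-sym {basisPoly o} {binomialOf o} (basisPoly≈binomial o)) y∈)

  basisPoly-monic : ∀ {a b} (o : Obstruction a b) → coeff (basisPoly o) (unit a ·ᵐ unit b) K.≈ K.1#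
  basisPoly-monic o = K.trans (basisPoly≈binomial o _) (binomial-coeff (lighter-≉ (trailing-weight tri quad o)))

  basisPoly-∈I-A : ∀ {a b} (o : Obstruction a b) → I-A (basisPoly o)
  basisPoly-∈I-A o with binomial-∈I-A (trailing-∼ᴬ o)
  ... | L , binomial≈L = L , ≈ᴾ-trans {basisPoly o} {binomialOf o} {combo L} (basisPoly≈binomial o) binomial≈L

  obstruction-unique : ∀ {a b} (o o′ : Obstruction a b) → basisPoly o ≡ basisPoly o′
  obstruction-unique (path _ _)    (path _ _)        = refl
  obstruction-unique (path _ _)    (cross _ j<k _)   = ⊥-elim (Finₚ.<-irrefl refl j<k)
  obstruction-unique (cross _ j<k _) (path _ _)      = ⊥-elim (Finₚ.<-irrefl refl j<k)
  obstruction-unique (cross _ _ _) (cross _ _ _)     = refl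

  obstruction-asym : ∀ {a b : Var d} → Obstruction a b → Obstruction b a → ⊥
  obstruction-asym (path i<j j<k)    (path _ _)        = Finₚ.<-asym i<j j<k
  obstruction-asym (path i<j _)      (cross j<i _ _)   = Finₚ.<-asym i<j j<i
  obstruction-asym (cross i<j j<k k<l) (path _ _)      = Finₚ.<-asym (Finₚ.<-trans i<j j<k) k<l
  obstruction-asym (cross i<j _ _)   (cross j<i _ _)   = Finₚ.<-asym i<j j<i

  standard-not-leading : ∀ {f u} → I-A f → IsLeading _≻_ f u → ¬ Standard u
  standard-not-leading {f} {u} (L , f≈L) (u∈f , u-max) su =
    fibreSum-concentrated (combo L) concentrated λ sum≈coeff →
      u∈f (K.trans (f≈L u) (K.trans (K.sym sum≈coeff) (fibreSum-ideal u L)))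
    where
    concentrated : Concentrated u (combo L)
    concentrated y u∼y y≉u y∈L =
      heavier⇒⊁ (standard-lightest tri quad su u∼y y≉u) (u-max y (InSupp-resp {f} {combo L} f≈L y∈L) y≉u)

  -- Trailing monomials are standard and leading arcs determine the obstruction.
  leading-arcs-in-support : ∀ {a b a′ b′ t} (o : Obstruction a b) (o′ : Obstruction a′ b′) →
                            InSupp (basisPoly o) t → a′ ∈ᵐ t → b′ ∈ᵐ t → basisPoly o ≡ basisPoly o′
  leading-arcs-in-support {a} {b} {a′} {b′} {t} o o′ t∈ a′∈t b′∈t with basisPoly-support o t∈
  ... | inj₂ t≗V = ⊥-elim (trailing-standard o (a′ , b′ , o′ , within a′∈t , within b′∈t))
    where
    within : ∀ {e} → e ∈ᵐ t → e ∈ᵐ trailing o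
    within {e} e∈t = ∈ᵐ-∣ᵐ {a = e} {t} e∈t (≗ᵐ⇒∣ᵐ t≗V)
  ... | inj₁ t≗U with ∈ᵐ-unit·unit-both {c = a} {c′ = b} (within a′∈t) (within b′∈t) (obstruction-≢ o′)
    where
    within : ∀ {e} → e ∈ᵐ t → e ∈ᵐ unit a ·ᵐ unit b
    within {e} e∈t = ∈ᵐ-∣ᵐ {a = e} {t} e∈t (≗ᵐ⇒∣ᵐ t≗U)
  ...   | inj₁ (refl , refl) = obstruction-unique o o′
  ...   | inj₂ (refl , refl) = ⊥-elim (obstruction-asym o o′)

  isReducedGB : IsReducedGB _≻_ I-A GdBasis
  isReducedGB = record { ⊆I = ⊆I ; monic = monic ; groebner = groebner ; reduced = reduced }
    where
    ⊆I : ∀ g → GdBasis g → I-A g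
    ⊆I g g∈G with GdBasis⇒basisPoly g∈G
    ... | _ , _ , o , refl = basisPoly-∈I-A o

    monic : ∀ g → GdBasis g → Σ (Monomial d) λ u → IsLeading _≻_ g u × coeff g u K.≈ K.1#
    monic g g∈G with GdBasis⇒basisPoly g∈G
    ... | _ , _ , o , refl = _ , basisPoly-leading o , basisPoly-monic o

    groebner : ∀ f → I-A f → ∀ u → IsLeading _≻_ f u →
               Σ Poly λ g → GdBasis g × Σ (Monomial d) λ v → IsLeading _≻_ g v × v ∣ᵐ u
    groebner f f∈I u u-lead with nonstandard? u
    ... | yes (a , b , o , a∈u , b∈u) =
      basisPoly o , basisPoly-∈ o , unit a ·ᵐ unit b , basisPoly-leading o , unit·unit-∣ᵐ a∈u b∈u (obstruction-≢ o)
    ... | no su = ⊥-elim (standard-not-leading {f} f∈I u-lead su)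

    reduced : ∀ g g′ → GdBasis g → GdBasis g′ → ¬ g ≈ᴾ g′ →
              ∀ v → IsLeading _≻_ g′ v → ∀ t → InSupp g t → ¬ v ∣ᵐ t
    reduced g g′ g∈G g′∈G g≉g′ v v-lead t t∈g v∣t with GdBasis⇒basisPoly g∈G | GdBasis⇒basisPoly g′∈G
    ... | _ , _ , o , refl | a′ , b′ , o′ , refl =
      g≉g′ (≈ᴾ-reflexive (leading-arcs-in-support o o′ t∈g (∈ᵐ-∣ᵐ (∈ᵐ-unit·unitˡ a′ b′) U′∣t)
                                                           (∈ᵐ-∣ᵐ (∈ᵐ-unit·unitʳ a′ b′) U′∣t)))
      where
      U′∣t : unit a′ ·ᵐ unit b′ ∣ᵐ t
      U′∣t = ∣ᵐ-trans (≗ᵐ⇒∣ᵐ (≗ᵐ-sym (basisPoly-leading-unique o′ v-lead))) v∣t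

theorem4p6 : ∀ {c ℓ} (K : Field c ℓ) {c′ ℓ′ ℓ<} (R : OrderedField c′ ℓ′ ℓ<)
             (d : ℕ) {ℓo} (T : TermOrder d ℓo)
             (w : Var d → OrderedField.Carrier R) →
             Weights.TriangleCond R d w →
             Weights.QuadCond R d w →
             Polynomials.IsReducedGB K d
               (Weights.refine R d w (TermOrder._≻_ T))
               (Polynomials.I-A K d)
               (Polynomials.GdBasis K d)
theorem4p6 K R d T w tri quad = ReducedBasis.isReducedGB K R d T w tri quad
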